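{- A leaf-colored tree with truncation map $(T,\sigma,u)$ is least resolved if and only if it does not contain a redundant edge.
   Context: All rooted trees are phylogenetic; $v\preceq_T u$ means $u$ is on the path from root $\rho_T$ to $v$; $\mathrm{lca}_T$ is the least common ancestor. In leaf-colored $(T,\sigma)$, $y$ is a best match of $x$ if $\sigma(x)\ne\sigma(y)$ and $\mathrm{lca}_T(x,y)\preceq_T\mathrm{lca}_T(x,y')$ for all leaves $y'$ with $\sigma(y')=\sigma(y)$. A truncation map $u\colon L(T)\times S\to V(T)$ (with $\sigma(L(T))\subseteq S$) sends $(x,s)$ to a vertex on the path from $\rho_T$ to $x$, with $u(x,\sigma(x))=x$; $y$ is a quasi-best match of $x$ if it is a best match and $\mathrm{lca}_T(x,y)\preceq_T u(x,\sigma(y))$. $\mathrm{qBMG}(T,\sigma,u)$ is the vertex-colored digraph on $L(T)$ with arcs $xy$ for quasi-best matches $y$ of $x$. For an edge $e$, $T_e$ is obtained by contracting $e$. An edge $e$ is redundant if some truncation map $u'$ on $T_e$ gives $\mathrm{qBMG}(T_e,\sigma,u')=\mathrm{qBMG}(T,\sigma,u)$. A tree $T'$ is displayed by $T$ ($T'\le T$) if $T'$ is obtained from the restriction of $T$ to a subset of its leaves (minimal subtree connecting them with degree-two non-root vertices suppressed) by a possibly empty sequence of inner-edge contractions; $T'<T$ means $T'\le T$ and $T'\ne T$. $(T,\sigma,u)$ is least resolved if there is no tree $T'<T$ and truncation map $u'$ such that $\mathrm{qBMG}(T',\sigma,u')=\mathrm{qBMG}(T,\sigma,u)$. -}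

module Defs where

open import Data.Nat using (ℕ)
open import Data.Bool using (Bool; true)
open import Data.Fin using (Fin)
open import Data.Fin.Subset using (Subset; _∈_; _⊆_; _⊂_; _∩_; ⁅_⁆; Nonempty; Empty)
open import Data.Product using (Σ; ∃; ∃-syntax; _×_; proj₁)
open import Data.Empty using (⊥)
open import Data.Sum using (_⊎_)
open import Relation.Nullary using (¬_)
open import Relation.Binary.PropositionalEquality using (_≡_; _≢_)
open import Function.Bundles using (_⇔_)

-- Phylogenetic rooted trees, represented (up to isomorphism fixing the
-- leaves) by their hierarchy of clusters.  A vertex v is identified with its cluster
-- C(v) = set of leaves below v; leaf x is the cluster ⁅ x ⁆, the root
-- is the cluster L(T) (the leaf set).  v ⪯ u  iff  C(v) ⊆ C(u).
-- (Hierarchies containing L and all singletons, with nonempty pairwise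
-- compatible clusters, correspond exactly to phylogenetic trees, i.e.
-- rooted trees without inner vertices having a single child.)

record Tree (n : ℕ) : Set where
  field
    L         : Subset n
    isCl      : Subset n → Bool
    root-cl   : isCl L ≡ true
    cl-nonempty : ∀ C → isCl C ≡ true → Nonempty C
    cl-⊆L     : ∀ C → isCl C ≡ true → C ⊆ L
    leaf-cl   : ∀ x → x ∈ L → isCl ⁅ x ⁆ ≡ true
    compatible : ∀ C D → isCl C ≡ true → isCl D ≡ true →
                 C ⊆ D ⊎ (D ⊆ C ⊎ Empty (C ∩ D))

open Tree public

Vtx : ∀ {n} → Tree n → Subset n → Set
Vtx T C = isCl T C ≡ true

Lca : ∀ {n} → Tree n → Fin n → Fin n → Subset n → Set
Lca T x y C = Vtx T C × x ∈ C × y ∈ C ×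
              (∀ D → Vtx T D → x ∈ D → y ∈ D → C ⊆ D)

record Trunc {n : ℕ} (T : Tree n) {S : Set} (σ : Fin n → S) : Set where
  field
    tr          : (x : Fin n) → x ∈ L T → S → Subset n
    tr-vertex   : ∀ x (p : x ∈ L T) s → Vtx T (tr x p s)
    tr-ancestor : ∀ x (p : x ∈ L T) s → x ∈ tr x p s      -- on path root → x
    tr-self     : ∀ x (p : x ∈ L T) → tr x p (σ x) ≡ ⁅ x ⁆

open Trunc public

BestMatch : ∀ {n} {S : Set} → Tree n → (Fin n → S) → Fin n → Fin n → Set
BestMatch T σ x y =
  x ∈ L T × (y ∈ L T × (σ x ≢ σ y ×
    (∀ y' → y' ∈ L T → σ y' ≡ σ y →
       ∀ C C' → Lca T x y C → Lca T x y' C' → C ⊆ C')))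

QuasiBestMatch : ∀ {n} {S : Set} (T : Tree n) (σ : Fin n → S) →
                 Trunc T σ → Fin n → Fin n → Set
QuasiBestMatch T σ u x y =
  Σ (BestMatch T σ x y) λ b →
    ∀ C → Lca T x y C → C ⊆ tr u x (proj₁ b) (σ y)

-- qBMG(T,σ,u) = qBMG(T',σ,u') : same vertex set (leaf set), same
-- colouring (σ is shared), same arcs.
SameQBMG : ∀ {n} {S : Set} (σ : Fin n → S) (T : Tree n) → Trunc T σ →
           (T' : Tree n) → Trunc T' σ → Set
SameQBMG σ T u T' u' =
  L T ≡ L T' × (∀ x y → QuasiBestMatch T σ u x y ⇔ QuasiBestMatch T' σ u' x y)

InnerEdge : ∀ {n} → Tree n → Subset n → Subset n → Set
InnerEdge T C D = Vtx T C × Vtx T D × D ⊂ C ×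
                  (∀ E → Vtx T E → D ⊂ E → E ⊂ C → ⊥) ×
                  (¬ (∃[ x ] D ≡ ⁅ x ⁆))

IsContraction : ∀ {n} → Tree n → Subset n → Subset n → Tree n → Set
IsContraction T C D Te =
  L Te ≡ L T × (∀ E → Vtx Te E ⇔ (Vtx T E × E ≢ D))

IsRestriction : ∀ {n} → Tree n → Subset n → Tree n → Set
IsRestriction T L' R =
  L R ≡ L' × (∀ C → Vtx R C ⇔ (Nonempty C × ∃[ D ] (Vtx T D × C ≡ D ∩ L')))

-- isomorphism of trees (fixing leaves) = equality of hierarchies
_≐_ : ∀ {n} → Tree n → Tree n → Set
T ≐ T' = L T ≡ L T' × (∀ C → isCl T C ≡ isCl T' C)

data ContrSeq {n : ℕ} : Tree n → Tree n → Set where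
  done : ∀ {T T'} → T ≐ T' → ContrSeq T T'
  step : ∀ {T Te T'} C D → InnerEdge T C D → IsContraction T C D Te →
         ContrSeq Te T' → ContrSeq T T'

_≤T_ : ∀ {n} → Tree n → Tree n → Set
T' ≤T T = ∃[ L' ] (L' ⊆ L T × ∃[ R ] (IsRestriction T L' R × ContrSeq R T'))

_<T_ : ∀ {n} → Tree n → Tree n → Set
T' <T T = T' ≤T T × ¬ (T' ≐ T)

HasRedundantEdge : ∀ {n} {S : Set} (T : Tree n) (σ : Fin n → S) → Trunc T σ → Set
HasRedundantEdge T σ u =
  ∃[ C ] ∃[ D ] (InnerEdge T C D × ∃[ Te ] (IsContraction T C D Te ×
     Σ (Trunc Te σ) λ u' → SameQBMG σ Te u' T u))

LeastResolved : ∀ {n} {S : Set} (T : Tree n) (σ : Fin n → S) → Trunc T σ → Set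
LeastResolved T σ u =
  ¬ (∃[ T' ] (T' <T T × Σ (Trunc T' σ) λ u' → SameQBMG σ T' u' T u))

-- Contracting a redundant edge yields a displayed tree with the same qBMG, which gives one
-- direction.  Conversely, a displayed tree T′ with the same qBMG has all the leaves of T, so it
-- arises from T by contractions alone; if T′ ≠ T, let Tₑ be the first contraction.  Since Tₑ
-- lies between T and T′, the truncation map of T′ is also one of Tₑ, and best matches pass from
-- finer to coarser trees, so qBMG(Tₑ) is squeezed between qBMG(T) and qBMG(T′), which are equal.
module Submission where

open import Defs
open import Data.Nat using (ℕ)
open import Data.Bool using (true)
open import Data.Bool.Properties using (⇔→≡) renaming (_≟_ to _≟ᴮ_)
open import Data.Fin using (Fin)
open import Data.Fin.Subset using (Subset; _∈_; _⊆_; _⊂_; _∩_)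
open import Data.Fin.Subset.Properties
  using (_∈?_; _⊂?_; anySubset?; ⊆-refl; ⊆-antisym; p∩q⊆p; x∈p∩q⁺)
open import Data.Fin.Subset.Induction using (Acc; acc; ⊂-wellFounded)
open import Data.Vec.Properties.WithK using ([]=-irrelevant)
open import Data.Product using (Σ; ∃; _×_; _,_; proj₁; proj₂; map₁)
open import Data.Sum using (inj₁; inj₂)
open import Data.Empty using (⊥-elim)
open import Function using (_∘_)
open import Relation.Nullary using (¬_; Dec; yes; no)
open import Relation.Nullary.Decidable using (_×-dec_; decidable-stable)
open import Relation.Binary.PropositionalEquality using (_≡_; refl; sym; trans; subst)
open import Function.Bundles using (_⇔_; mk⇔; Equivalence)
open import Function.Construct.Composition using (_⇔-∘_)
open import Function.Construct.Symmetry using (⇔-sym)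

open Equivalence

private
  variable
    n : ℕ
    S : Set
    σ : Fin n → S
    x y : Fin n
    C D W L′ : Subset n
    A B T T′ Te R R′ : Tree n

module _ (T : Tree n) (x y : Fin n) where

  private
    CommonAncestorBelow : Subset n → Subset n → Set
    CommonAncestorBelow C D = Vtx T D × x ∈ D × y ∈ D × D ⊂ C

    commonAncestorBelow? : ∀ C D → Dec (CommonAncestorBelow C D)
    commonAncestorBelow? C D = (isCl T D ≟ᴮ true) ×-dec (x ∈? D) ×-dec (y ∈? D) ×-dec (D ⊂? C)

  -- A vertex with no smaller vertex containing x and y is their lca by compatibility.
  lca-below : ∀ C → Acc _⊂_ C → Vtx T C → x ∈ C → y ∈ C → ∃ (Lca T x y)
  lca-below C (acc smaller) vC xC yC with anySubset? (commonAncestorBelow? C)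
  ... | yes (D , vD , xD , yD , D⊂C) = lca-below D (smaller D⊂C) vD xD yD
  ... | no none = C , vC , xC , yC , least
    where
    least : ∀ D → Vtx T D → x ∈ D → y ∈ D → C ⊆ D
    least D vD xD yD {z} zC with compatible T C D vC vD
    ... | inj₁ C⊆D = C⊆D zC
    ... | inj₂ (inj₂ disjoint) = ⊥-elim (disjoint (x , x∈p∩q⁺ (xC , xD)))
    ... | inj₂ (inj₁ D⊆C) =
      decidable-stable (z ∈? D) λ z∉D → none (D , vD , xD , yD , D⊆C , z , zC , z∉D)

lca-exists : (T : Tree n) → x ∈ L T → y ∈ L T → ∃ (Lca T x y)
lca-exists T xL yL = lca-below T _ _ (L T) (⊂-wellFounded (L T)) (root-cl T) xL yL

lca⊆⇔∈ : Vtx T W → x ∈ W → x ∈ L T → y ∈ L T → (∀ C → Lca T x y C → C ⊆ W) ⇔ y ∈ W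
lca⊆⇔∈ {T = T} {W = W} {x = x} {y = y} vW xW xL yL = mk⇔ below⇒∈ ∈⇒below
  where
  below⇒∈ : (∀ C → Lca T x y C → C ⊆ W) → y ∈ W
  below⇒∈ below with lca-exists T xL yL
  ... | C , lca@(_ , _ , yC , _) = below C lca yC

  ∈⇒below : y ∈ W → ∀ C → Lca T x y C → C ⊆ W
  ∈⇒below yW C (_ , _ , _ , least) = least W vW xW yW

QuasiBestMatch⇔ : (u : Trunc T σ) →
  QuasiBestMatch T σ u x y ⇔ Σ (BestMatch T σ x y) λ b → y ∈ tr u x (proj₁ b) (σ y)
QuasiBestMatch⇔ {T = T} {σ = σ} {x = x} {y = y} u = mk⇔
  (λ { (b , below) → b , to (truncated b) below })
  (λ { (b , yW) → b , from (truncated b) yW })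
  where
  truncated : (b : BestMatch T σ x y) →
    (∀ C → Lca T x y C → C ⊆ tr u x (proj₁ b) (σ y)) ⇔ y ∈ tr u x (proj₁ b) (σ y)
  truncated (xL , yL , _) = lca⊆⇔∈ {T = T} (tr-vertex u x xL (σ y)) (tr-ancestor u x xL (σ y)) xL yL

record Refines (A B : Tree n) : Set where
  constructor refines
  field
    same-leaves : L A ≡ L B
    Vtx-coarser : ∀ C → Vtx B C → Vtx A C

open Refines

Refines-trans : Refines A B → Refines B T → Refines A T
Refines-trans (refines eqL vtx) (refines eqL′ vtx′) = refines (trans eqL eqL′) λ C → vtx C ∘ vtx′ C

≐⇒Refines : A ≐ B → Refines A B
≐⇒Refines (eqL , eqCl) = refines eqL λ C → trans (eqCl C)

IsContraction⇒Refines : IsContraction T C D Te → Refines T Te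
IsContraction⇒Refines (eqL , vtx) = refines (sym eqL) λ E → proj₁ ∘ to (vtx E)

ContrSeq⇒Refines : ContrSeq A B → Refines A B
ContrSeq⇒Refines (done iso) = ≐⇒Refines iso
ContrSeq⇒Refines (step {Te = Te} C D _ c rest) =
  Refines-trans (IsContraction⇒Refines {C = C} {D = D} {Te = Te} c) (ContrSeq⇒Refines rest)

BestMatch-coarsen : Refines A B → BestMatch A σ x y → BestMatch B σ x y
BestMatch-coarsen {A = A} {B = B} {σ = σ} {x = x} {y = y}
  (refines eqL vtx) (xA , yA , σx≢σy , best) =
  subst (x ∈_) eqL xA , subst (y ∈_) eqL yA , σx≢σy , best′
  where
  best′ : ∀ y′ → y′ ∈ L B → σ y′ ≡ σ y → ∀ C C′ → Lca B x y C → Lca B x y′ C′ → C ⊆ C′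
  best′ y′ y′B σy′≡σy C C′ (_ , _ , _ , leastC) (vC′ , xC′ , y′C′ , _) = leastC C′ vC′ xC′ yC′
    where
    y′A : y′ ∈ L A
    y′A = subst (y′ ∈_) (sym eqL) y′B

    -- lca_A(x, y) ⊆ lca_A(x, y′) ⊆ C′, as C′ is a vertex of A too.
    yC′ : y ∈ C′
    yC′ with lca-exists A xA yA | lca-exists A xA y′A
    ... | D , lcaD@(_ , _ , yD , _) | D′ , lcaD′@(_ , _ , _ , leastD′) =
      leastD′ C′ (vtx C′ vC′) xC′ y′C′ (best y′ y′A σy′≡σy D D′ lcaD lcaD′ yD)

Trunc-refine : Refines A B → Trunc B σ → Trunc A σ
Trunc-refine {A = A} {B = B} (refines eqL vtx) u = record
  { tr          = λ x p → tr u x (cast p)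
  ; tr-vertex   = λ x p s → vtx _ (tr-vertex u x (cast p) s)
  ; tr-ancestor = λ x p → tr-ancestor u x (cast p)
  ; tr-self     = λ x p → tr-self u x (cast p)
  }
  where
  cast : ∀ {x} → x ∈ L A → x ∈ L B
  cast {x} = subst (x ∈_) eqL

QuasiBestMatch-coarsen : (r : Refines A B) (u : Trunc B σ) →
  QuasiBestMatch A σ (Trunc-refine r u) x y → QuasiBestMatch B σ u x y
QuasiBestMatch-coarsen r u q with to (QuasiBestMatch⇔ (Trunc-refine r u)) q
... | b , yW = from (QuasiBestMatch⇔ u) (BestMatch-coarsen r b , yW)

QuasiBestMatch-refine : (r : Refines A B) (u : Trunc B σ) → BestMatch A σ x y →
  QuasiBestMatch B σ u x y → QuasiBestMatch A σ (Trunc-refine r u) x y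
QuasiBestMatch-refine {σ = σ} {x = x} {y = y} r u bA q with to (QuasiBestMatch⇔ u) q
... | b , yW = from (QuasiBestMatch⇔ (Trunc-refine r u))
  (bA , subst (λ p → y ∈ tr u x p (σ y)) ([]=-irrelevant (proj₁ b) _) yW)

SameQBMG-between : ∀ {u : Trunc T σ} {u′ : Trunc T′ σ} (r : Refines T Te) (r′ : Refines Te T′) →
  SameQBMG σ T′ u′ T u → SameQBMG σ Te (Trunc-refine r′ u′) T u
SameQBMG-between {u′ = u′} r r′ (_ , same) = sym (same-leaves r) , λ x y → mk⇔
  (to (same x y) ∘ QuasiBestMatch-coarsen r′ u′)
  (λ q → QuasiBestMatch-refine r′ u′ (BestMatch-coarsen r (proj₁ q)) (from (same x y) q))

≐-sym : A ≐ B → B ≐ A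
≐-sym (eqL , eqCl) = sym eqL , λ C → sym (eqCl C)

≐-trans : A ≐ B → B ≐ T → A ≐ T
≐-trans (eqL , eqCl) (eqL′ , eqCl′) = trans eqL eqL′ , λ C → trans (eqCl C) (eqCl′ C)

module _ {A B : Tree n} (iso : A ≐ B) where

  ≐-Vtx : Vtx A C → Vtx B C
  ≐-Vtx {C = C} = trans (sym (proj₂ iso C))

  ≐-Vtx⁻ : Vtx B C → Vtx A C
  ≐-Vtx⁻ {C = C} = trans (proj₂ iso C)

  InnerEdge-≐ : InnerEdge A C D → InnerEdge B C D
  InnerEdge-≐ (vC , vD , D⊂C , noneBetween , notLeaf) =
    ≐-Vtx vC , ≐-Vtx vD , D⊂C , (λ E → noneBetween E ∘ ≐-Vtx⁻) , notLeaf

  IsContraction-≐ : IsContraction A C D Te → IsContraction B C D Te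
  IsContraction-≐ (eqL , vtx) = trans eqL (proj₁ iso) , λ E →
    mk⇔ (map₁ ≐-Vtx ∘ to (vtx E)) (from (vtx E) ∘ map₁ ≐-Vtx⁻)

  ContrSeq-≐ : ContrSeq A T → ContrSeq B T
  ContrSeq-≐ {T = T} (done iso′) =
    done (≐-trans {A = B} {B = A} {T = T} (≐-sym {A = A} {B = B} iso) iso′)
  ContrSeq-≐ (step {Te = Te} C D e c rest) =
    step C D (InnerEdge-≐ e) (IsContraction-≐ {C = C} {D = D} {Te = Te} c) rest

∩-leaves : (T : Tree n) → Vtx T D → D ∩ L T ≡ D
∩-leaves {D = D} T vD = ⊆-antisym (p∩q⊆p D (L T)) (λ zD → x∈p∩q⁺ (zD , cl-⊆L T D vD zD))

restriction-to-leaves : (T : Tree n) → IsRestriction T (L T) T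
restriction-to-leaves T = refl , λ C → mk⇔
  (λ vC → cl-nonempty T C vC , C , vC , sym (∩-leaves T vC))
  (λ { (_ , D , vD , refl) → subst (Vtx T) (sym (∩-leaves T vD)) vD })

IsRestriction-unique : IsRestriction T L′ R → IsRestriction T L′ R′ → R ≐ R′
IsRestriction-unique (eqL , vtx) (eqL′ , vtx′) =
  trans eqL (sym eqL′) , λ C → ⇔→≡ (⇔-sym (vtx′ C) ⇔-∘ vtx C)

≤T-same-leaves : T′ ≤T T → L T′ ≡ L T → ContrSeq T T′
≤T-same-leaves {T′ = T′} {T = T} (L′ , _ , R , restr , cs) eqL =
  ContrSeq-≐ {A = R} {B = T} R≐T cs
  where
  L′≡L : L′ ≡ L T
  L′≡L = trans (sym (proj₁ restr)) (trans (same-leaves (ContrSeq⇒Refines cs)) eqL)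

  restrToLeaves : IsRestriction T (L T) R
  restrToLeaves = subst (λ L″ → IsRestriction T L″ R) L′≡L restr

  R≐T : R ≐ T
  R≐T = IsRestriction-unique {T = T} {R = R} {R′ = T} restrToLeaves (restriction-to-leaves T)

contraction-<T : InnerEdge T C D → IsContraction T C D Te → Te <T T
contraction-<T {T = T} {C = C} {D = D} {Te = Te} e@(_ , vD , _) c@(_ , vtx) =
  (L T , ⊆-refl , T , restriction-to-leaves T , step {Te = Te} C D e c (done (refl , λ _ → refl)))
  ,
  λ iso → proj₂ (to (vtx D) (≐-Vtx⁻ {A = Te} {B = T} iso vD)) refl

lemma8 : ∀ {n : ℕ} {S : Set} (T : Tree n) (σ : Fin n → S) (u : Trunc T σ) →
           LeastResolved T σ u ⇔ (¬ HasRedundantEdge T σ u)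
lemma8 T σ u = mk⇔ noRedundantEdge leastResolved
  where
  noRedundantEdge : LeastResolved T σ u → ¬ HasRedundantEdge T σ u
  noRedundantEdge lr (C , D , e , Te , c , u′ , same) =
    lr (Te , contraction-<T {T = T} {C = C} {D = D} {Te = Te} e c , u′ , same)

  leastResolved : ¬ HasRedundantEdge T σ u → LeastResolved T σ u
  leastResolved nr (T′ , (T′≤T , T′≉T) , u′ , same)
    with ≤T-same-leaves {T′ = T′} {T = T} T′≤T (proj₁ same)
  ... | done T≐T′ = T′≉T (≐-sym {A = T} {B = T′} T≐T′)
  ... | step {Te = Te} C D e c rest =
    nr (C , D , e , Te , c , Trunc-refine Te⊑T′ u′ ,
        SameQBMG-between {u = u} {u′ = u′} T⊑Te Te⊑T′ same)
    where
    T⊑Te : Refines T Te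
    T⊑Te = IsContraction⇒Refines {C = C} {D = D} c

    Te⊑T′ : Refines Te T′
    Te⊑T′ = ContrSeq⇒Refines rest
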